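{- Let $\mathcal{H} = \{H_n\}_{n=0}^{\infty}$ and $\mathcal{R} = \{R_n\}_{n=0}^{\infty}$ be sequences of nonempty finite sets of positive integers. Then: (i) If $A$ is a basis of order $\mathcal{H}$, or if $A$ is a finite basis of order $\mathcal{H}$ with $\max(A) \geq 1$, then $0,1 \in A$. (ii) If $A$ is an $\mathcal{R}$-basis of order $\mathcal{H}$, or if $A$ is a finite $\mathcal{R}$-basis of order $\mathcal{H}$ with $\max(A) \geq 1$, then $|H_0| \in R_0$ and $|H_1| \in R_1$. (iii) If $A$ is an $\mathcal{R}$-basis of order $\mathcal{H}$, then $A_N = A \cap [0,N]$ is a finite $\mathcal{R}$-basis of order $\mathcal{H}$ for every $N \geq 0$. (iv) If $A \neq \{0\}$ is a finite $\mathcal{R}$-basis of order $\mathcal{H}$, then $A \setminus \{\max(A)\}$ is also a finite $\mathcal{R}$-basis of order $\mathcal{H}$.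
   Context: For a set $A$ of nonnegative integers, a nonnegative integer $n$ and a positive integer $h$, $r_A(n,h)$ denotes the number of representations $n = a_1 + \cdots + a_h$ with $a_1,\ldots,a_h \in A$ and $a_1 \leq \cdots \leq a_h$; and $r_A(n,H_n) = \sum_{h_n \in H_n} r_A(n,h_n)$. For real $a,b$, $[a,b]$ denotes the set of integers $n$ with $a\le n\le b$; $|X|$ is the cardinality of $X$. A set $A$ of nonnegative integers is a basis of order $\mathcal{H}$ if $r_A(n,H_n)\ge 1$ for all $n\ge 0$, and an $\mathcal{R}$-basis of order $\mathcal{H}$ if $r_A(n,H_n)\in R_n$ for all $n\ge 0$. A nonempty finite set $A$ of nonnegative integers is a finite basis of order $\mathcal{H}$ if $r_A(n,H_n)\ge 1$ for all $n \in [0,\max(A)]$, and a finite $\mathcal{R}$-basis of order $\mathcal{H}$ if $r_A(n,H_n)\in R_n$ for all $n\in[0,\max(A)]$. -}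

module Defs where

open import Data.Bool using (Bool; true; false; _∧_; not; if_then_else_)
open import Data.Nat using (ℕ; zero; suc; _+_; _∸_; _≤_; _<_; _≡ᵇ_)
open import Data.List using (List; []; _∷_; [_]; map; concatMap; filterᵇ; upTo; length)
open import Data.Nat.ListAction using (sum)
open import Data.List.Membership.Propositional using (_∈_)
open import Data.List.Relation.Unary.All using (All)
open import Data.List.Relation.Unary.Unique.Propositional using (Unique)
open import Data.Product using (Σ; _×_)
open import Relation.Binary.PropositionalEquality using (_≡_)
open import Relation.Nullary using (¬_)

NatSet : Set
NatSet = ℕ → Bool

record FinPosSet (X : List ℕ) : Set where
  field
    nonempty : ¬ (X ≡ [])
    unique   : Unique X
    positive : All (λ x → 1 ≤ x) X

-- reps A lo h n : the list of all nondecreasing lists  a₁ ≤ ⋯ ≤ a_h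
-- with all aᵢ ∈ A, lo ≤ a₁, and a₁ + ⋯ + a_h = n.
reps : NatSet → ℕ → ℕ → ℕ → List (List ℕ)
reps A lo zero    n = if n ≡ᵇ 0 then [ [] ] else []
reps A lo (suc h) n =
  concatMap (λ a → map (a ∷_) (reps A a h (n ∸ a)))
            (filterᵇ A (map (lo +_) (upTo (suc n ∸ lo))))

r : NatSet → ℕ → ℕ → ℕ
r A n h = length (reps A 0 h n)

rH : NatSet → (ℕ → List ℕ) → ℕ → ℕ
rH A H n = sum (map (r A n) (H n))

-- m is the maximum of A (so A is nonempty and finite).
IsMax : NatSet → ℕ → Set
IsMax A m = (A m ≡ true) × (∀ k → m < k → A k ≡ false)

Basis : (ℕ → List ℕ) → NatSet → Set
Basis H A = ∀ n → 1 ≤ rH A H n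

RBasis : (ℕ → List ℕ) → (ℕ → List ℕ) → NatSet → Set
RBasis H R A = ∀ n → rH A H n ∈ R n

FiniteBasisMax : (ℕ → List ℕ) → NatSet → ℕ → Set
FiniteBasisMax H A m = IsMax A m × (∀ n → n ≤ m → 1 ≤ rH A H n)

FiniteRBasisMax : (ℕ → List ℕ) → (ℕ → List ℕ) → NatSet → ℕ → Set
FiniteRBasisMax H R A m = IsMax A m × (∀ n → n ≤ m → rH A H n ∈ R n)

FiniteRBasis : (ℕ → List ℕ) → (ℕ → List ℕ) → NatSet → Set
FiniteRBasis H R A = Σ ℕ (λ m → FiniteRBasisMax H R A m)

truncate : NatSet → ℕ → NatSet
truncate A N k = A k ∧ (k Data.Nat.≤ᵇ N)

remove : NatSet → ℕ → NatSet
remove A m k = A k ∧ not (k ≡ᵇ m)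

zeroSet : NatSet
zeroSet k = k ≡ᵇ 0

{-# OPTIONS --safe #-}
module Submission where

-- A representation of n uses only summands ≤ n, so r_A(n, h) depends only on A ∩ [0, n].
-- Since every order h is positive, 0 is represented only if 0 ∈ A, and then exactly once
-- (0 + ⋯ + 0), while 1 is represented only if 1 ∈ A, and then (given 0 ∈ A) exactly once
-- (0 + ⋯ + 0 + 1); hence r_A(0, H₀) = |H₀| and r_A(1, H₁) = |H₁|.  For (iii) and (iv) the
-- smaller set agrees with A up to its own maximum, so it inherits the counts of A there.

open import Defs
open import Data.Bool using (Bool; true; false)
open import Data.Bool.Properties using (T-≡; ∧-identityʳ; ∧-zeroʳ)
open import Data.Empty using (⊥-elim)
open import Data.List using (List; []; _∷_; [_]; map; concatMap; filterᵇ; upTo; length; replicate; _∷ʳ_)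
open import Data.List.Membership.Propositional using (_∈_)
open import Data.List.Properties using (concatMap-cong; map-cong)
open import Data.List.Relation.Unary.All as All using (All; []; _∷_)
open import Data.List.Relation.Unary.All.Properties using (map⁺; applyUpTo⁺₁)
open import Data.Nat
open import Data.Nat.ListAction using (sum)
open import Data.Nat.Properties
open import Data.Product using (Σ; _×_; _,_)
open import Data.Sum using (inj₁; inj₂)
open import Function using (_∘_)
open import Function.Bundles using (Equivalence)
open import Relation.Binary.PropositionalEquality using (_≡_; _≢_; refl; sym; trans; cong; cong₂; subst; module ≡-Reasoning)
open import Relation.Nullary using (¬_; contradiction; yes; no)

open Equivalence using (to; from)

filterᵇ-cong : ∀ {p q : ℕ → Bool} {xs} → All (λ x → p x ≡ q x) xs → filterᵇ p xs ≡ filterᵇ q xs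
filterᵇ-cong [] = refl
filterᵇ-cong {p} {q} {x ∷ _} (px≡qx ∷ eqs) with p x | q x | px≡qx
... | true  | true  | refl = cong (x ∷_) (filterᵇ-cong eqs)
... | false | false | refl = filterᵇ-cong eqs

sum-map-positive-const : ∀ {f : ℕ → ℕ} {c} {xs} → All (1 ≤_) xs → (∀ h → f (suc h) ≡ c) →
                         sum (map f xs) ≡ length xs * c
sum-map-positive-const [] f-const = refl
sum-map-positive-const (s≤s _ ∷ pos) f-const = cong₂ _+_ (f-const _) (sum-map-positive-const pos f-const)

≡true-if-nonzero : ∀ {b : Bool} {n} → (b ≡ false → n ≡ 0) → 1 ≤ n → b ≡ true
≡true-if-nonzero {true}  _        _   = refl
≡true-if-nonzero {false} false⇒0 1≤n = contradiction (false⇒0 refl) (n>0⇒n≢0 1≤n)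

candidates≤ : ∀ lo n → All (_≤ n) (map (lo +_) (upTo (suc n ∸ lo)))
candidates≤ lo n = map⁺ (applyUpTo⁺₁ _ _ bound)
  where
  bound : ∀ {i} → i < suc n ∸ lo → lo + i ≤ n
  bound {i} i< = ≤-pred (subst (_≤ suc n) (cong suc (+-comm i lo)) (m≤o∸n⇒m+n≤o (suc i) lo≤1+n i<))
    where
    lo≤1+n : lo ≤ suc n
    lo≤1+n = <⇒≤ (m∸n≢0⇒n<m (λ eq → n≮0 (subst (i <_) eq i<)))

module _ {A B : NatSet} where

  reps-local : ∀ h lo n → (∀ k → k ≤ n → A k ≡ B k) → reps A lo h n ≡ reps B lo h n
  reps-local zero    lo n agree = refl
  reps-local (suc h) lo n agree = begin
    startingWith A (filterᵇ A candidates) ≡⟨ cong (startingWith A) (filterᵇ-cong (All.map (agree _) (candidates≤ lo n))) ⟩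
    startingWith A (filterᵇ B candidates) ≡⟨ concatMap-cong tails-agree (filterᵇ B candidates) ⟩
    startingWith B (filterᵇ B candidates) ∎
    where
    open ≡-Reasoning
    candidates : List ℕ
    candidates = map (lo +_) (upTo (suc n ∸ lo))
    startingWith : NatSet → List ℕ → List (List ℕ)
    startingWith C = concatMap (λ a → map (a ∷_) (reps C a h (n ∸ a)))
    tails-agree : ∀ a → map (a ∷_) (reps A a h (n ∸ a)) ≡ map (a ∷_) (reps B a h (n ∸ a))
    tails-agree a = cong (map (a ∷_)) (reps-local h a (n ∸ a) (λ k k≤ → agree k (≤-trans k≤ (m∸n≤m n a))))

  rH-local : ∀ H n → (∀ k → k ≤ n → A k ≡ B k) → rH A H n ≡ rH B H n
  rH-local H n agree = cong sum (map-cong (λ h → cong length (reps-local h 0 n agree)) (H n))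

module _ {A : NatSet} where

  reps-zero-absent : A 0 ≡ false → ∀ h → reps A 0 (suc h) 0 ≡ []
  reps-zero-absent A0 h rewrite A0 = refl

  reps-one-absent : A 1 ≡ false → ∀ h → reps A 0 h 1 ≡ []
  reps-one-absent A1 zero = refl
  reps-one-absent A1 (suc h) with A 0
  ... | false rewrite A1 = refl
  ... | true  rewrite A1 | reps-one-absent A1 h = refl

  reps-zero : A 0 ≡ true → ∀ h → reps A 0 h 0 ≡ [ replicate h 0 ]
  reps-zero A0 zero = refl
  reps-zero A0 (suc h) rewrite A0 | reps-zero A0 h = refl

  reps-one : A 0 ≡ true → A 1 ≡ true → ∀ h → reps A 0 (suc h) 1 ≡ [ replicate h 0 ∷ʳ 1 ]
  reps-one A0 A1 zero rewrite A0 | A1 = refl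
  reps-one A0 A1 (suc h) rewrite A0 | A1 | reps-one A0 A1 h = refl

module _ {H : ℕ → List ℕ} (H-positive : ∀ n → All (1 ≤_) (H n)) {A : NatSet} where

  rH-zero-absent : A 0 ≡ false → rH A H 0 ≡ 0
  rH-zero-absent A0 = trans (sum-map-positive-const (H-positive 0) (cong length ∘ reps-zero-absent {A} A0))
                            (*-zeroʳ (length (H 0)))

  rH-one-absent : A 1 ≡ false → rH A H 1 ≡ 0
  rH-one-absent A1 = trans (sum-map-positive-const (H-positive 1) (cong length ∘ reps-one-absent {A} A1 ∘ suc))
                           (*-zeroʳ (length (H 1)))

  rH-zero : A 0 ≡ true → rH A H 0 ≡ length (H 0)
  rH-zero A0 = trans (sum-map-positive-const (H-positive 0) (cong length ∘ reps-zero {A} A0 ∘ suc))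
                     (*-identityʳ (length (H 0)))

  rH-one : A 0 ≡ true → A 1 ≡ true → rH A H 1 ≡ length (H 1)
  rH-one A0 A1 = trans (sum-map-positive-const (H-positive 1) (cong length ∘ reps-one {A} A0 A1))
                       (*-identityʳ (length (H 1)))

  zero-∈ : 1 ≤ rH A H 0 → A 0 ≡ true
  zero-∈ = ≡true-if-nonzero rH-zero-absent

  one-∈ : 1 ≤ rH A H 1 → A 1 ≡ true
  one-∈ = ≡true-if-nonzero rH-one-absent

module _ {B : NatSet} where

  IsMax-exists : ∀ N → B 0 ≡ true → (∀ k → N < k → B k ≡ false) → Σ ℕ (IsMax B)
  IsMax-exists zero    B0 above = 0 , B0 , above
  IsMax-exists (suc N) B0 above with B (suc N) in BN
  ... | true  = suc N , BN , above
  ... | false = IsMax-exists N B0 above-N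
    where
    above-N : ∀ k → N < k → B k ≡ false
    above-N k N<k with m≤n⇒m<n∨m≡n N<k
    ... | inj₁ 1+N<k = above k 1+N<k
    ... | inj₂ refl  = BN

  IsMax⇒≤ : ∀ {m N} → IsMax B m → (∀ k → N < k → B k ≡ false) → m ≤ N
  IsMax⇒≤ {m} {N} (Bm , _) above with m ≤? N
  ... | yes m≤N = m≤N
  ... | no  m≰N = contradiction (trans (sym Bm) (above m (≰⇒> m≰N))) λ ()

  IsMax-zero : IsMax B 0 → ∀ k → B k ≡ zeroSet k
  IsMax-zero (B0 , _)    zero    = B0
  IsMax-zero (_ , above) (suc k) = above (suc k) z<s

finiteRBasis-of-agreement : ∀ {H R : ℕ → List ℕ} {A B : NatSet} N →
  (∀ n → n ≤ N → rH A H n ∈ R n) → A 0 ≡ true →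
  (∀ k → k ≤ N → A k ≡ B k) → (∀ k → N < k → B k ≡ false) → FiniteRBasis H R B
finiteRBasis-of-agreement {H} {R} {A} {B} N basis A0 agree above
  with IsMax-exists N (trans (sym (agree 0 z≤n)) A0) above
... | m , max = m , max , basis-B
  where
  basis-B : ∀ n → n ≤ m → rH B H n ∈ R n
  basis-B n n≤m = subst (_∈ R n) (rH-local H n (λ k k≤n → agree k (≤-trans k≤n n≤N))) (basis n n≤N)
    where
    n≤N : n ≤ N
    n≤N = ≤-trans n≤m (IsMax⇒≤ max above)

module _ (A : NatSet) where

  truncate-≤ : ∀ {N k} → k ≤ N → A k ≡ truncate A N k
  truncate-≤ {N} {k} k≤N rewrite to T-≡ (≤⇒≤ᵇ k≤N) = sym (∧-identityʳ (A k))

  truncate-> : ∀ {N k} → N < k → truncate A N k ≡ false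
  truncate-> {N} {k} N<k with k ≤ᵇ N in k≤ᵇN
  ... | false = ∧-zeroʳ (A k)
  ... | true  = contradiction (≤ᵇ⇒≤ k N (from T-≡ k≤ᵇN)) (<⇒≱ N<k)

  remove-≢ : ∀ {m k} → k ≢ m → A k ≡ remove A m k
  remove-≢ {m} {k} k≢m with k ≡ᵇ m in k≡ᵇm
  ... | false = sym (∧-identityʳ (A k))
  ... | true  = contradiction (≡ᵇ⇒≡ k m (from T-≡ k≡ᵇm)) k≢m

  remove-self : ∀ m → remove A m m ≡ false
  remove-self m rewrite to T-≡ (≡⇒≡ᵇ m m refl) = ∧-zeroʳ (A m)

  remove-absent : ∀ {m k} → A k ≡ false → remove A m k ≡ false
  remove-absent Ak rewrite Ak = refl

module _ {H R : ℕ → List ℕ} (H-positive : ∀ n → All (1 ≤_) (H n)) (R-positive : ∀ n → All (1 ≤_) (R n))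
         {A : NatSet} where

  ∈R⇒positive : ∀ {n x} → x ∈ R n → 1 ≤ x
  ∈R⇒positive {n} = All.lookup (R-positive n)

  lengths-∈ : rH A H 0 ∈ R 0 → rH A H 1 ∈ R 1 → (length (H 0) ∈ R 0) × (length (H 1) ∈ R 1)
  lengths-∈ r0 r1 = subst (_∈ R 0) (rH-zero H-positive A0) r0
                  , subst (_∈ R 1) (rH-one H-positive A0 (one-∈ H-positive (∈R⇒positive r1))) r1
    where
    A0 : A 0 ≡ true
    A0 = zero-∈ H-positive (∈R⇒positive r0)

  truncate-finiteRBasis : RBasis H R A → ∀ N → FiniteRBasis H R (truncate A N)
  truncate-finiteRBasis basis N =
    finiteRBasis-of-agreement {H} {R} {A} N (λ n _ → basis n) (zero-∈ H-positive (∈R⇒positive (basis 0)))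
      (λ _ → truncate-≤ A) (λ _ → truncate-> A)

  remove-max-finiteRBasis : ∀ m → FiniteRBasisMax H R A m → ¬ (∀ k → A k ≡ zeroSet k) →
                            FiniteRBasis H R (remove A m)
  remove-max-finiteRBasis zero    (max , _) A≢0 = ⊥-elim (A≢0 (IsMax-zero max))
  remove-max-finiteRBasis (suc m) ((_ , above) , basis) _ =
    finiteRBasis-of-agreement {H} {R} {A} m (λ n n≤m → basis n (m≤n⇒m≤1+n n≤m))
      (zero-∈ H-positive (∈R⇒positive (basis 0 z≤n))) (λ k k≤m → remove-≢ A (<⇒≢ (s≤s k≤m))) above-m
    where
    above-m : ∀ k → m < k → remove A (suc m) k ≡ false
    above-m k m<k with m≤n⇒m<n∨m≡n m<k
    ... | inj₁ 1+m<k = remove-absent A (above k 1+m<k)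
    ... | inj₂ refl  = remove-self A (suc m)

theorem2 : (H R : ℕ → List ℕ) → (∀ n → FinPosSet (H n)) → (∀ n → FinPosSet (R n)) →
    ((A : NatSet) → Basis H A → (A 0 ≡ true) × (A 1 ≡ true))
    × ((A : NatSet) (m : ℕ) → FiniteBasisMax H A m → 1 ≤ m → (A 0 ≡ true) × (A 1 ≡ true))
    × ((A : NatSet) → RBasis H R A → (length (H 0) ∈ R 0) × (length (H 1) ∈ R 1))
    × ((A : NatSet) (m : ℕ) → FiniteRBasisMax H R A m → 1 ≤ m → (length (H 0) ∈ R 0) × (length (H 1) ∈ R 1))
    × ((A : NatSet) → RBasis H R A → (N : ℕ) → FiniteRBasis H R (truncate A N))
    × ((A : NatSet) (m : ℕ) → FiniteRBasisMax H R A m → ¬ (∀ k → A k ≡ zeroSet k) → FiniteRBasis H R (remove A m))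
theorem2 H R H-fin R-fin =
    (λ A basis → zero-∈ H⁺ (basis 0) , one-∈ H⁺ (basis 1))
  , (λ A m (_ , basis) 1≤m → zero-∈ H⁺ (basis 0 z≤n) , one-∈ H⁺ (basis 1 1≤m))
  , (λ A basis → lengths-∈ H⁺ R⁺ (basis 0) (basis 1))
  , (λ A m (_ , basis) 1≤m → lengths-∈ H⁺ R⁺ (basis 0 z≤n) (basis 1 1≤m))
  , (λ A → truncate-finiteRBasis H⁺ R⁺)
  , (λ A → remove-max-finiteRBasis H⁺ R⁺)
  where
  H⁺ : ∀ n → All (1 ≤_) (H n)
  H⁺ = FinPosSet.positive ∘ H-fin
  R⁺ : ∀ n → All (1 ≤_) (R n)
  R⁺ = FinPosSet.positive ∘ R-fin
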